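{- For every $n\geq 2$, $\kappa(BH_n;K_{1,1})\leq 2n$ and $\kappa^s(BH_n;K_{1,1})\leq 2n$.
   Context: The $n$-dimensional balanced hypercube $BH_n$ ($n\ge 1$) is the graph with vertex set $\{0,1,2,3\}^n$, vertices written $(a_0,a_1,\dots,a_{n-1})$, in which $(a_0,\dots,a_{n-1})$ is adjacent exactly to the $2n$ vertices $((a_0\pm 1)\bmod 4,a_1,\dots,a_{n-1})$ and, for each $1\le i\le n-1$, $((a_0\pm1)\bmod 4,a_1,\dots,a_{i-1},(a_i+(-1)^{a_0})\bmod 4,a_{i+1},\dots,a_{n-1})$. For a connected graph $G$ and a set $F$ of connected subgraphs of $G$, let $V(F)$ be the union of their vertex sets; $F$ is a subgraph-cut if $G-V(F)$ is disconnected or trivial. For a connected subgraph $H$ of $G$, an $H$-structure-cut is a subgraph-cut each of whose elements is isomorphic to $H$, and $\kappa(G;H)$ is the minimum cardinality of an $H$-structure-cut; an $H$-substructure-cut is a subgraph-cut each of whose elements is isomorphic to a connected subgraph of $H$, and $\kappa^s(G;H)$ is the minimum cardinality of an $H$-substructure-cut. $K_{1,1}$ is the graph consisting of a single edge. -}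

module Defs where

open import Data.Nat using (ℕ; suc; _≤_; _*_)
open import Data.Fin using (Fin; zero; suc)
open import Data.Vec using (Vec; _∷_; updateAt)
open import Data.List using (List; length)
open import Data.List.Relation.Unary.Any using (Any)
open import Data.Product using (Σ; ∃; ∃-syntax; _×_; _,_)
open import Data.Sum using (_⊎_)
open import Data.Empty using (⊥)
open import Relation.Nullary using (¬_)
open import Relation.Binary.PropositionalEquality using (_≡_)

inc4 : Fin 4 → Fin 4
inc4 zero                   = suc zero
inc4 (suc zero)             = suc (suc zero)
inc4 (suc (suc zero))       = suc (suc (suc zero))
inc4 (suc (suc (suc zero))) = zero

dec4 : Fin 4 → Fin 4
dec4 zero                   = suc (suc (suc zero))
dec4 (suc zero)             = zero
dec4 (suc (suc zero))       = suc zero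
dec4 (suc (suc (suc zero))) = suc (suc zero)

shift : Fin 4 → Fin 4 → Fin 4
shift zero                   = inc4
shift (suc zero)             = dec4
shift (suc (suc zero))       = inc4
shift (suc (suc (suc zero))) = dec4

BHVertex : ℕ → Set
BHVertex n = Vec (Fin 4) n

-- (a₀ ∷ as) ~ (b₀ ∷ bs) iff b₀ = a₀ ± 1 (mod 4) and either bs = as
-- (the "0-dimensional" neighbours) or, for some 1 ≤ i ≤ n-1 (an index
-- i' : Fin (n-1) into the tail), bs is as with its i-th entry shifted
-- by (-1)^{a₀}.
BHAdj : {n : ℕ} → BHVertex n → BHVertex n → Set
BHAdj {suc m} (a₀ ∷ as) (b₀ ∷ bs) =
  (b₀ ≡ inc4 a₀ ⊎ b₀ ≡ dec4 a₀) ×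
  (bs ≡ as ⊎ ∃[ i ] bs ≡ updateAt as i (shift a₀))
BHAdj {0} _ _ = ⊥

module GraphNotions (V : Set) (Adj : V → V → Set) where

  record EdgeSub : Set where
    constructor edge
    field
      end₁ end₂ : V
      adj : Adj end₁ end₂

  -- a subgraph isomorphic to a connected subgraph of K_{1,1}:
  -- either a single vertex (K_1) or an edge (K_{1,1})
  data SubK11 : Set where
    vertexSub : V → SubK11
    edgeSub   : EdgeSub → SubK11

  edgeVerts : EdgeSub → V → Set
  edgeVerts (edge u v _) x = x ≡ u ⊎ x ≡ v

  subVerts : SubK11 → V → Set
  subVerts (vertexSub u) x = x ≡ u
  subVerts (edgeSub e)   x = edgeVerts e x

  -- walks in G - X, where X : V → Set is the deleted vertex set
  data Reach (X : V → Set) : V → V → Set where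
    here : ∀ {u} → ¬ X u → Reach X u u
    step : ∀ {u w v} → ¬ X u → Adj u w → Reach X w v → Reach X u v

  Disconnected : (V → Set) → Set
  Disconnected X = ∃[ u ] ∃[ v ] (¬ X u × ¬ X v × ¬ Reach X u v)

  Trivial : (V → Set) → Set
  Trivial X = ∃[ u ] (¬ X u × (∀ v → ¬ X v → v ≡ u))

  IsSubgraphCut : (V → Set) → Set
  IsSubgraphCut X = Disconnected X ⊎ Trivial X

  VF : {S : Set} → (S → V → Set) → List S → V → Set
  VF verts F x = Any (λ s → verts s x) F

  κK11≤ : ℕ → Set
  κK11≤ k = ∃[ F ] (length F ≤ k × IsSubgraphCut (VF edgeVerts F))

  κsK11≤ : ℕ → Set
  κsK11≤ k = ∃[ F ] (length F ≤ k × IsSubgraphCut (VF subVerts F))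

module BH (n : ℕ) = GraphNotions (BHVertex n) (BHAdj {n})

module Submission where

-- Put x₀ = 0ⁿ.  Every neighbour of x₀ has the form
-- (a, t) with a ∈ {1,3} and t ∈ T = {0ⁿ⁻¹} ∪ {e_i | 0 ≤ i < n-1}, where
-- e_i is the unit vector with a 1 in position i.  For each t ∈ T the
-- vertex (2, t) is adjacent to both (1, t) and (3, t), so the 2n edges
-- {(1,t),(2,t)} and {(3,t),(2,t)} (t ∈ T) cover the whole neighbourhood
-- of x₀ while missing every vertex with first coordinate 0.  Deleting
-- them isolates x₀ from the surviving vertex (0, e₀), which gives a
-- K_{1,1}-structure-cut of size 2n.  Every edge is in particular a
-- connected subgraph of K_{1,1}, so the same family is also a
-- K_{1,1}-substructure-cut.

open import Defs
open import Data.Nat using (ℕ; _≤_; _*_; _+_; suc; s≤s; z≤n)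
open import Data.Nat.Properties using (≤-reflexive; ≤-trans; +-identityʳ)
open import Data.Product using (_×_; _,_; ∃; proj₂)
open import Data.Sum using (_⊎_; inj₁; inj₂)
open import Data.Fin using (Fin) renaming (zero to 0F; suc to sucF)
open import Data.Vec using (Vec; _∷_; replicate; updateAt)
open import Data.List using (List; _∷_; _++_; length; allFin) renaming (map to mapL)
open import Data.List.Properties using (length-map; length-++; length-tabulate)
open import Data.List.Membership.Propositional using (_∈_)
open import Data.List.Membership.Propositional.Properties using (∈-map⁺; ∈-allFin)
open import Data.List.Relation.Unary.Any as Any using (Any)
open import Data.List.Relation.Unary.Any.Properties using (map⁺; map⁻; ++⁺ˡ; ++⁺ʳ; ++⁻)
open import Relation.Binary.PropositionalEquality
  using (_≡_; refl; cong; cong₂; trans; sym; module ≡-Reasoning)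
open import Relation.Nullary using (¬_)

module CutFacts (V : Set) (Adj : V → V → Set) where
  open GraphNotions V Adj

  isolate-cut : ∀ {X : V → Set} (x y : V) →
                (∀ w → Adj x w → X w) → ¬ X x → ¬ X y → ¬ y ≡ x →
                IsSubgraphCut X
  isolate-cut {X} x y N⊆X x∉X y∉X y≢x = inj₁ (x , y , x∉X , y∉X , stuck)
    where
    stuck : ¬ Reach X x y
    stuck (here _)                    = y≢x refl
    stuck (step _ x~w (here w∉X))     = w∉X (N⊆X _ x~w)
    stuck (step _ x~w (step w∉X _ _)) = w∉X (N⊆X _ x~w)

  reach-anti : ∀ {X Y : V → Set} → (∀ v → Y v → X v) →
               ∀ {u v} → Reach X u v → Reach Y u v
  reach-anti Y⊆X (here u∉X)       = here (λ u∈Y → u∉X (Y⊆X _ u∈Y))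
  reach-anti Y⊆X (step u∉X u~w r) = step (λ u∈Y → u∉X (Y⊆X _ u∈Y)) u~w (reach-anti Y⊆X r)

  cut-resp : ∀ {X Y : V → Set} → (∀ v → X v → Y v) → (∀ v → Y v → X v) →
             IsSubgraphCut X → IsSubgraphCut Y
  cut-resp X⊆Y Y⊆X (inj₁ (u , v , u∉X , v∉X , ¬r)) =
    inj₁ (u , v , (λ u∈Y → u∉X (Y⊆X _ u∈Y)) , (λ v∈Y → v∉X (Y⊆X _ v∈Y)) ,
          (λ r → ¬r (reach-anti X⊆Y r)))
  cut-resp X⊆Y Y⊆X (inj₂ (u , u∉X , unique)) =
    inj₂ (u , (λ u∈Y → u∉X (Y⊆X _ u∈Y)) , (λ v v∉Y → unique v (λ v∈X → v∉Y (X⊆Y _ v∈X))))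

  structure⇒substructure : ∀ {k} → κK11≤ k → κsK11≤ k
  structure⇒substructure (F , |F|≤k , cut) =
    mapL edgeSub F ,
    ≤-trans (≤-reflexive (length-map edgeSub F)) |F|≤k ,
    cut-resp (λ _ → map⁺) (λ _ → map⁻) cut

length-two-maps : ∀ {A B : Set} (f g : A → B) (xs : List A) →
                  length (mapL f xs ++ mapL g xs) ≡ 2 * length xs
length-two-maps f g xs = begin
  length (mapL f xs ++ mapL g xs)         ≡⟨ length-++ (mapL f xs) ⟩
  length (mapL f xs) + length (mapL g xs) ≡⟨ cong₂ _+_ (length-map f xs) (length-map g xs) ⟩
  length xs + length xs                   ≡⟨ cong (length xs +_) (sym (+-identityʳ (length xs))) ⟩
  2 * length xs                           ∎
  where open ≡-Reasoning

module Star (k : ℕ) where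
  m n : ℕ
  m = suc k
  n = suc m
  open BH n
  open CutFacts (BHVertex n) (BHAdj {n})

  1F 2F 3F : Fin 4
  1F = sucF 0F
  2F = sucF (sucF 0F)
  3F = sucF (sucF (sucF 0F))

  zeros : Vec (Fin 4) m
  zeros = replicate m 0F

  unit : Fin m → Vec (Fin 4) m
  unit i = updateAt zeros i inc4

  T : List (Vec (Fin 4) m)
  T = zeros ∷ mapL unit (allFin m)

  |T| : length T ≡ n
  |T| = cong suc (trans (length-map unit (allFin m)) (length-tabulate {n = m} (λ i → i)))

  edge₁ edge₃ : Vec (Fin 4) m → EdgeSub
  edge₁ t = edge (1F ∷ t) (2F ∷ t) (inj₁ refl , inj₁ refl)
  edge₃ t = edge (3F ∷ t) (2F ∷ t) (inj₂ refl , inj₁ refl)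

  F : List EdgeSub
  F = mapL edge₁ T ++ mapL edge₃ T

  |F| : length F ≡ 2 * n
  |F| = trans (length-two-maps edge₁ edge₃ T) (cong (2 *_) |T|)

  x₀ : BHVertex n
  x₀ = 0F ∷ zeros

  -- The tail of a neighbour of x₀ lies in T (at a₀ = 0 the shift is +1).
  tail∈T : ∀ t → (t ≡ zeros ⊎ ∃ λ i → t ≡ updateAt zeros i (shift 0F)) → t ∈ T
  tail∈T t (inj₁ t≡0)        = Any.here t≡0
  tail∈T t (inj₂ (i , refl)) = Any.there (∈-map⁺ unit (∈-allFin i))

  covers-N[x₀] : ∀ w → BHAdj x₀ w → VF edgeVerts F w
  covers-N[x₀] (_ ∷ t) (inj₁ refl , tail) =
    ++⁺ˡ (map⁺ (Any.map (λ eq → inj₁ (cong (1F ∷_) eq)) (tail∈T t tail)))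
  covers-N[x₀] (_ ∷ t) (inj₂ refl , tail) =
    ++⁺ʳ (mapL edge₁ T) (map⁺ (Any.map (λ eq → inj₁ (cong (3F ∷_) eq)) (tail∈T t tail)))

  misses-layer₀ : ∀ t → ¬ VF edgeVerts F (0F ∷ t)
  misses-layer₀ t p with ++⁻ (mapL edge₁ T) p
  ... | inj₁ p₁ with proj₂ (Any.satisfied (map⁻ p₁))
  ...   | inj₁ ()
  ...   | inj₂ ()
  misses-layer₀ t p | inj₂ p₃ with proj₂ (Any.satisfied (map⁻ p₃))
  ...   | inj₁ ()
  ...   | inj₂ ()

  structure-cut : κK11≤ (2 * n)
  structure-cut =
    F , ≤-reflexive |F| ,
    isolate-cut x₀ (0F ∷ unit 0F) covers-N[x₀]
      (misses-layer₀ zeros) (misses-layer₀ (unit 0F)) (λ ())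

lemma8 : (n : ℕ) → 2 ≤ n → BH.κK11≤ n (2 * n) × BH.κsK11≤ n (2 * n)
lemma8 (suc (suc k)) (s≤s (s≤s z≤n)) = structure-cut , structure⇒substructure structure-cut
  where
  open Star k using (structure-cut)
  open CutFacts (BHVertex (suc (suc k))) (BHAdj {suc (suc k)}) using (structure⇒substructure)
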